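{- Let $d\ge 0$ be an integer, $\mathbb{F}$ a field, $V$ an $\mathbb{F}$-vector space of dimension $d+1$, and $T\in{\rm Mat}_{d+1}(\mathbb{F})$ an invertible upper triangular matrix (rows and columns indexed by $0,\dots,d$). Let $\{u_i\}_{i=0}^d$ be a basis of $V$ and define $v_j=\sum_{i=0}^d T_{ij}u_i$ for $0\le j\le d$ (so $\{v_i\}_{i=0}^d$ is a basis of $V$). For $0\le i\le d$ define $U_i=\mathbb{F}u_0+\cdots+\mathbb{F}u_i$ $(=\mathbb{F}v_0+\cdots+\mathbb{F}v_i)$, $U'_i=\mathbb{F}u_d+\mathbb{F}u_{d-1}+\cdots+\mathbb{F}u_{d-i}$, $U''_i=\mathbb{F}v_d+\mathbb{F}v_{d-1}+\cdots+\mathbb{F}v_{d-i}$. Then the three flags $\{U_i\}_{i=0}^d$, $\{U'_i\}_{i=0}^d$, $\{U''_i\}_{i=0}^d$ are totally opposite if and only if $T$ is very good.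
   Context: For $A\in{\rm Mat}_{d+1}(\mathbb{F})$ and $0\le i\le j\le d$, $A[i,j]$ denotes the $(j-i+1)\times(j-i+1)$ submatrix $(A_{kl})_{0\le k\le j-i,\ i\le l\le j}$ (rows $0,\dots,j-i$ and columns $i,\dots,j$). The matrix $A$ is called very good if $A[i,j]$ is invertible for all $0\le i\le j\le d$. A flag on $V$ is a sequence $\{W_i\}_{i=0}^d$ of subspaces with $\dim W_i=i+1$ and $W_{i-1}\subseteq W_i$. Three flags $\{W_i\},\{W'_i\},\{W''_i\}$ on $V$ are totally opposite if $W_{d-r}\cap W'_{d-s}\cap W''_{d-t}=0$ for all $0\le r,s,t\le d$ with $r+s+t>d$. -}

module Defs where

open import Level using (Level; _⊔_)
open import Data.Nat as ℕ using (ℕ; zero; suc; _∸_; _≤_; _<_)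
open import Data.Fin as Fin using (Fin; toℕ; fromℕ<; opposite)
open import Data.Product using (Σ; ∃; _×_; _,_)
open import Relation.Nullary using (¬_; yes; no)
open import Algebra.Bundles using (CommutativeRing)
open import Algebra.Module.Bundles using (Module)

module LinAlg {c ℓ : Level} (F : CommutativeRing c ℓ) where
  open CommutativeRing F

  record IsField : Set (c ⊔ ℓ) where
    field
      0≉1     : ¬ (0# ≈ 1#)
      inverse : ∀ x → ¬ (x ≈ 0#) → ∃ λ y → x * y ≈ 1#

  ΣF : (n : ℕ) → (Fin n → Carrier) → Carrier
  ΣF zero    f = 0#
  ΣF (suc n) f = f Fin.zero + ΣF n (λ i → f (Fin.suc i))

  Mat : ℕ → Set c
  Mat n = Fin n → Fin n → Carrier

  _·_ : {n : ℕ} → Mat n → Mat n → Mat n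
  (A · B) i j = ΣF _ (λ k → A i k * B k j)

  I : {n : ℕ} → Mat n
  I i j with i Fin.≟ j
  ... | yes _ = 1#
  ... | no  _ = 0#

  _≈Mat_ : {n : ℕ} → Mat n → Mat n → Set ℓ
  A ≈Mat B = ∀ i j → A i j ≈ B i j

  Invertible : {n : ℕ} → Mat n → Set (c ⊔ ℓ)
  Invertible A = ∃ λ B → ((A · B) ≈Mat I) × ((B · A) ≈Mat I)

  UpperTriangular : {n : ℕ} → Mat n → Set ℓ
  UpperTriangular A = ∀ i j → toℕ j < toℕ i → A i j ≈ 0#

  -- entry (k,l) of a (d+1)×(d+1) matrix indexed by naturals (0 outside range;
  -- only used in range below)
  entry : {d : ℕ} → Mat (suc d) → ℕ → ℕ → Carrier
  entry {d} A k l with k ℕ.<? suc d | l ℕ.<? suc d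
  ... | yes p | yes q = A (fromℕ< p) (fromℕ< q)
  ... | _     | _     = 0#

  -- A[i,j] : rows 0,…,j-i and columns i,…,j of A
  Sub : {d : ℕ} → Mat (suc d) → (i j : ℕ) → Mat (suc (j ∸ i))
  Sub A i j a b = entry A (toℕ a) (i ℕ.+ toℕ b)

  VeryGood : {d : ℕ} → Mat (suc d) → Set (c ⊔ ℓ)
  VeryGood {d} A = ∀ i j → i ≤ j → j ≤ d → Invertible (Sub A i j)

  module Space {m ℓm : Level} (V : Module F m ℓm) where
    open Module V

    ΣV : (n : ℕ) → (Fin n → Carrierᴹ) → Carrierᴹ
    ΣV zero    f = 0ᴹ
    ΣV (suc n) f = f Fin.zero +ᴹ ΣV n (λ i → f (Fin.suc i))

    lincomb : {n : ℕ} → (Fin n → Carrier) → (Fin n → Carrierᴹ) → Carrierᴹ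
    lincomb {n} a w = ΣV n (λ k → a k *ₗ w k)

    IsBasis : {n : ℕ} → (Fin n → Carrierᴹ) → Set (c ⊔ ℓ ⊔ m ⊔ ℓm)
    IsBasis {n} w =
      (∀ (a : Fin n → Carrier) → lincomb a w ≈ᴹ 0ᴹ → ∀ k → a k ≈ 0#)
      × (∀ x → ∃ λ (a : Fin n → Carrier) → x ≈ᴹ lincomb a w)

    Subspace : (ℓp : Level) → Set (m ⊔ Level.suc ℓp)
    Subspace ℓp = Carrierᴹ → Set ℓp

    Span : {n : ℕ} → (Fin n → Carrierᴹ) → (Fin n → Set) → Subspace (c ⊔ ℓ ⊔ ℓm)
    Span {n} w P x =
      ∃ λ (a : Fin n → Carrier) → (∀ k → ¬ P k → a k ≈ 0#) × (x ≈ᴹ lincomb a w)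

    -- three flags {W_i}, {W'_i}, {W''_i} (i = 0..d) are totally opposite:
    -- W_{d-r} ∩ W'_{d-s} ∩ W''_{d-t} = 0 whenever r+s+t > d
    TotallyOpposite : {d : ℕ} {ℓp : Level} → (W W' W'' : Fin (suc d) → Subspace ℓp)
                    → Set (m ⊔ ℓm ⊔ ℓp)
    TotallyOpposite {d} W W' W'' =
      ∀ (r s t : Fin (suc d)) → d < toℕ r ℕ.+ toℕ s ℕ.+ toℕ t →
      ∀ x → W (opposite r) x → W' (opposite s) x → W'' (opposite t) x → x ≈ᴹ 0ᴹ

module Submission where

-- For x = Σ_j b_j v_j, with u-coordinates T b: x ∈ U″_{d-t} says b vanishes
-- below t, x ∈ U′_{d-s} says T b vanishes below s, and x ∈ U_{d-r} says T b,
-- hence b (T is invertible upper triangular), vanishes from d-r+1 on.  So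
-- total oppositeness means: T is window-injective, i.e. a vector supported
-- in [t, t+s) whose image vanishes in the first s coordinates is zero
-- (module Flags).  On such vectors the first rows of T act as the submatrix
-- T[t,j] (Submatrix.row-window); hence very good implies window-injective,
-- and conversely window-injectivity makes all leading blocks of each T[i,j]
-- injective, which over a field forces invertibility by Gaussian elimination
-- without pivoting (module Elimination).  These are combined in MatrixForm.

open import Defs
open import Level using (Level; _⊔_)
open import Data.Nat as ℕ using (ℕ; zero; suc; _≤_; _<_; _∸_; z≤n; s≤s)
import Data.Nat.Properties as ℕP
open import Data.Nat.Tactic.RingSolver using (solve-∀)
open import Data.Fin as Fin using (Fin; toℕ; opposite)
import Data.Fin.Properties as FinP
open import Data.Product using (∃; Σ; _×_; _,_; proj₁; proj₂)
open import Data.Vec.Functional using (_∷_)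
open import Function using (_∘_)
open import Function.Bundles using (_⇔_; mk⇔)
open import Relation.Nullary using (¬_; yes; no; contradiction)
open import Relation.Binary.PropositionalEquality as ≡ using (_≡_; _≢_)
open import Relation.Binary.Definitions using (tri<; tri≈; tri>)
open import Algebra.Bundles using (CommutativeMonoid; CommutativeRing)
open import Algebra.Module.Bundles using (Module)

module FiniteSums {a ℓ} (M : CommutativeMonoid a ℓ) where
  open CommutativeMonoid M
  open import Algebra.Properties.CommutativeMonoid.Sum M public
    using (sum; sum-cong-≋; ∑-comm; ∑-distrib-+)
  open import Algebra.Properties.CommutativeMonoid.Sum M using (sum-replicate-zero)

  sum-zero : ∀ {n} (f : Fin n → Carrier) → (∀ i → f i ≈ ε) → sum f ≈ ε
  sum-zero {n} f f≈ε = trans (sum-cong-≋ f≈ε) (sum-replicate-zero n)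

  sum-single : ∀ {n} (f : Fin n → Carrier) (j : Fin n) → (∀ k → k ≢ j → f k ≈ ε) → sum f ≈ f j
  sum-single f Fin.zero others =
    trans (∙-congˡ (sum-zero _ (λ k → others (Fin.suc k) (λ ())))) (identityʳ _)
  sum-single f (Fin.suc j) others =
    trans (∙-congʳ (others Fin.zero (λ ())))
          (trans (identityˡ _) (sum-single _ j (λ k k≢j → others (Fin.suc k) (k≢j ∘ FinP.suc-injective))))

module Matrices {c ℓ} (F : CommutativeRing c ℓ) where
  open CommutativeRing F
  open LinAlg F
  open FiniteSums +-commutativeMonoid public
  open import Algebra.Properties.Semiring.Sum semiring using (*-distribˡ-sum; *-distribʳ-sum)
  open import Algebra.Properties.Ring ring using (-0#≈0#; -‿+-comm)
  open import Relation.Binary.Reasoning.Setoid setoid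

  ΣF≡sum : ∀ n (f : Fin n → Carrier) → ΣF n f ≡ sum f
  ΣF≡sum zero    f = ≡.refl
  ΣF≡sum (suc n) f = ≡.cong (f Fin.zero +_) (ΣF≡sum n (λ i → f (Fin.suc i)))

  sum-neg : ∀ {n} (f : Fin n → Carrier) → - sum f ≈ sum (λ i → - f i)
  sum-neg {zero}  f = -0#≈0#
  sum-neg {suc n} f = trans (sym (-‿+-comm _ _)) (+-congˡ (sum-neg (λ i → f (Fin.suc i))))

  Vanish : ∀ {n} → (ℕ → Set) → (Fin n → Carrier) → Set ℓ
  Vanish P x = ∀ k → P (toℕ k) → x k ≈ 0#

  infixr 7 _⊛_
  _⊛_ : ∀ {n} → Mat n → (Fin n → Carrier) → Fin n → Carrier
  (A ⊛ x) i = sum (λ k → A i k * x k)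

  ⊛-cong : ∀ {n} (A : Mat n) {x y : Fin n → Carrier} → (∀ k → x k ≈ y k) → ∀ i → (A ⊛ x) i ≈ (A ⊛ y) i
  ⊛-cong A x≈y i = sum-cong-≋ (λ k → *-congˡ (x≈y k))

  ⊛-zero : ∀ {n} (A : Mat n) {x : Fin n → Carrier} → (∀ k → x k ≈ 0#) → ∀ i → (A ⊛ x) i ≈ 0#
  ⊛-zero A x≈0 i = sum-zero _ (λ k → trans (*-congˡ (x≈0 k)) (zeroʳ _))

  I-diag : ∀ {n} (i : Fin n) → I i i ≈ 1#
  I-diag i with i Fin.≟ i
  ... | yes _  = refl
  ... | no i≢i = contradiction ≡.refl i≢i

  I-off : ∀ {n} (i j : Fin n) → i ≢ j → I i j ≈ 0#
  I-off i j i≢j with i Fin.≟ j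
  ... | yes i≡j = contradiction i≡j i≢j
  ... | no _    = refl

  ⊛-I : ∀ {n} (x : Fin n → Carrier) i → (I ⊛ x) i ≈ x i
  ⊛-I x i = begin
    sum (λ k → I i k * x k) ≈⟨ sum-single _ i (λ k k≢i → trans (*-congʳ (I-off i k (k≢i ∘ ≡.sym))) (zeroˡ _)) ⟩
    I i i * x i             ≈⟨ trans (*-congʳ (I-diag i)) (*-identityˡ _) ⟩
    x i                     ∎

  ⊛-· : ∀ {n} (A B : Mat n) x i → ((A · B) ⊛ x) i ≈ (A ⊛ (B ⊛ x)) i
  ⊛-· {n} A B x i = begin
    sum (λ k → (A · B) i k * x k)                ≈⟨ sum-cong-≋ {n} (λ k → *-congʳ (reflexive (ΣF≡sum n _))) ⟩
    sum (λ k → sum (λ l → A i l * B l k) * x k)   ≈⟨ sum-cong-≋ {n} (λ k → *-distribʳ-sum {n} (x k) _) ⟩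
    sum (λ k → sum (λ l → A i l * B l k * x k))   ≈⟨ ∑-comm {n} {n} _ ⟩
    sum (λ l → sum (λ k → A i l * B l k * x k))   ≈⟨ sum-cong-≋ {n} (λ l → sum-cong-≋ {n} (λ k → *-assoc _ _ _)) ⟩
    sum (λ l → sum (λ k → A i l * (B l k * x k))) ≈⟨ sum-cong-≋ {n} (λ l → *-distribˡ-sum {n} (A i l) _) ⟨
    sum (λ l → A i l * (B ⊛ x) l)                 ∎

  left-inverse-recovers : ∀ {n} {A B : Mat n} → (B · A) ≈Mat I → ∀ x i → x i ≈ (B ⊛ (A ⊛ x)) i
  left-inverse-recovers {A = A} {B} BA≈I x i = begin
    x i                 ≈⟨ ⊛-I x i ⟨
    (I ⊛ x) i           ≈⟨ sum-cong-≋ (λ k → *-congʳ (BA≈I i k)) ⟨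
    ((B · A) ⊛ x) i     ≈⟨ ⊛-· B A x i ⟩
    (B ⊛ (A ⊛ x)) i     ∎

  left-invertible⇒injective : ∀ {n} {A B : Mat n} → (B · A) ≈Mat I →
                              ∀ x → (∀ k → (A ⊛ x) k ≈ 0#) → ∀ i → x i ≈ 0#
  left-invertible⇒injective {B = B} BA≈I x Ax≈0 i =
    trans (left-inverse-recovers BA≈I x i) (⊛-zero B Ax≈0 i)

  upper-preserves-tail : ∀ {n} {T : Mat n} → UpperTriangular T →
                         ∀ w x → Vanish (w ≤_) x → Vanish (w ≤_) (T ⊛ x)
  upper-preserves-tail {T = T} T-upper w x tail i w≤i = sum-zero _ term≈0
    where
    term≈0 : ∀ k → T i k * x k ≈ 0#
    term≈0 k with toℕ k ℕ.<? toℕ i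
    ... | yes k<i = trans (*-congʳ (T-upper i k k<i)) (zeroˡ _)
    ... | no  k≮i = trans (*-congˡ (tail k (ℕP.≤-trans w≤i (ℕP.≮⇒≥ k≮i)))) (zeroʳ _)

  -- By
  -- induction on the column l: below the diagonal, column l of S·T = I
  -- reduces to S k l * T l l, so S l l * T l l ≈ 1 and S k l * T l l ≈ 0.
  module InverseOfUpper {n} {T S : Mat n} (T-upper : UpperTriangular T) (ST≈I : (S · T) ≈Mat I) where

    ST-column : ∀ l → (∀ l′ → toℕ l′ < toℕ l → ∀ k → toℕ l′ < toℕ k → S k l′ ≈ 0#) →
                ∀ k → toℕ l ≤ toℕ k → S k l * T l l ≈ (S · T) k l
    ST-column l earlier k l≤k = sym (trans (reflexive (ΣF≡sum n _)) (sum-single _ l others))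
      where
      others : ∀ j → j ≢ l → S k j * T j l ≈ 0#
      others j j≢l with ℕP.<-cmp (toℕ j) (toℕ l)
      ... | tri< j<l _ _ = trans (*-congʳ (earlier j j<l k (ℕP.<-≤-trans j<l l≤k))) (zeroˡ _)
      ... | tri≈ _ j≡l _ = contradiction (FinP.toℕ-injective j≡l) j≢l
      ... | tri> _ _ l<j = trans (*-congˡ (T-upper j l l<j)) (zeroʳ _)

    below-diagonal : ∀ m l → toℕ l < m → ∀ k → toℕ l < toℕ k → S k l ≈ 0#
    below-diagonal (suc m) l (s≤s l≤m) k l<k = begin
      S k l                   ≈⟨ *-identityʳ _ ⟨
      S k l * 1#              ≈⟨ *-congˡ (trans (*-comm _ _) pivot) ⟨
      S k l * (T l l * S l l) ≈⟨ *-assoc _ _ _ ⟨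
      S k l * T l l * S l l   ≈⟨ *-congʳ (trans (column k (ℕP.<⇒≤ l<k)) (trans (ST≈I k l) (I-off k l k≢l))) ⟩
      0# * S l l              ≈⟨ zeroˡ _ ⟩
      0#                      ∎
      where
      column : ∀ k → toℕ l ≤ toℕ k → S k l * T l l ≈ (S · T) k l
      column = ST-column l (λ l′ l′<l → below-diagonal m l′ (ℕP.<-≤-trans l′<l l≤m))
      pivot : S l l * T l l ≈ 1#
      pivot = trans (column l ℕP.≤-refl) (trans (ST≈I l l) (I-diag l))
      k≢l : k ≢ l
      k≢l k≡l = ℕP.<-irrefl (≡.cong toℕ (≡.sym k≡l)) l<k

    inverse-upper : UpperTriangular S
    inverse-upper k l = below-diagonal n l (FinP.toℕ<n l) k

  -- If T x vanishes from index w on, so does x (apply the upper triangular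
  -- left inverse of T to T x).
  upper-reflects-tail : ∀ {n} {T : Mat n} → UpperTriangular T → Invertible T →
                        ∀ w x → Vanish (w ≤_) (T ⊛ x) → Vanish (w ≤_) x
  upper-reflects-tail T-upper (S , _ , ST≈I) w x tail k w≤k =
    trans (left-inverse-recovers ST≈I x k)
          (upper-preserves-tail (InverseOfUpper.inverse-upper T-upper ST≈I) w _ tail k w≤k)

-- Over a field, a matrix all of whose leading principal blocks are injective
-- is invertible: Gaussian elimination without pivoting works, because the
-- pivot A₀₀ is nonzero and its Schur complement inherits the hypothesis.
module Elimination {c ℓ} (F : CommutativeRing c ℓ) (F-field : LinAlg.IsField F) where
  open CommutativeRing F
  open LinAlg F
  open IsField F-field
  open Matrices F
  open import Algebra.Properties.Semiring.Sum semiring using (*-distribˡ-sum)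
  open import Algebra.Properties.Ring ring using (x[y-z]≈xy-xz; //-rightDividesˡ; -‿distribˡ-*; x∙y⁻¹≈ε⇒x≈y)
  open import Algebra.Solver.CommutativeMonoid +-commutativeMonoid using (solve; _⊕_; _⊜_)
  open import Relation.Binary.Reasoning.Setoid setoid

  LeadingInjective : ∀ {n} → Mat n → Set (c ⊔ ℓ)
  LeadingInjective {n} A =
    ∀ m → m ≤ n → ∀ x → Vanish (m ≤_) x → Vanish (_< m) (A ⊛ x) → ∀ l → x l ≈ 0#

  sum-sub : ∀ {n} (f g : Fin n → Carrier) → sum (λ l → f l - g l) ≈ sum f - sum g
  sum-sub {n} f g = trans (∑-distrib-+ {n} f _) (+-congˡ (sym (sum-neg g)))

  ⊛-sub : ∀ {n} (A : Mat n) x y i → (A ⊛ (λ k → x k - y k)) i ≈ (A ⊛ x) i - (A ⊛ y) i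
  ⊛-sub {n} A x y i = trans (sum-cong-≋ {n} (λ k → x[y-z]≈xy-xz (A i k) (x k) (y k)))
                            (sum-sub {n} (λ k → A i k * x k) (λ k → A i k * y k))

  pivot≉0 : ∀ {n} (A : Mat (suc n)) → LeadingInjective A → ¬ (A Fin.zero Fin.zero ≈ 0#)
  pivot≉0 {n} A inj p≈0 = 0≉1 (sym (inj 1 (s≤s z≤n) e₀ e₀-tail e₀-image Fin.zero))
    where
    e₀ : Fin (suc n) → Carrier
    e₀ = 1# ∷ λ _ → 0#
    e₀-tail : Vanish (1 ≤_) e₀
    e₀-tail (Fin.suc k) _ = refl
    e₀-image : Vanish (_< 1) (A ⊛ e₀)
    e₀-image (Fin.suc k) (s≤s ())
    e₀-image Fin.zero _ =
      trans (+-cong (trans (*-identityʳ _) p≈0) (sum-zero {n} _ (λ _ → zeroʳ _))) (+-identityˡ 0#)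

  module Pivot {n} (A : Mat (suc n)) (q : Carrier) (pq≈1 : A Fin.zero Fin.zero * q ≈ 1#) where

    row₀ : (Fin n → Carrier) → Carrier
    row₀ x = sum (λ l → A Fin.zero (Fin.suc l) * x l)
    rowₛ : (Fin n → Carrier) → Fin n → Carrier
    rowₛ x k = sum (λ l → A (Fin.suc k) (Fin.suc l) * x l)

    mult : Fin n → Carrier
    mult k = A (Fin.suc k) Fin.zero * q

    schur : Mat n
    schur k l = A (Fin.suc k) (Fin.suc l) - mult k * A Fin.zero (Fin.suc l)

    schur-row : ∀ x k → (schur ⊛ x) k ≈ rowₛ x k - mult k * row₀ x
    schur-row x k = begin
      sum (λ l → (A (Fin.suc k) (Fin.suc l) - mult k * A Fin.zero (Fin.suc l)) * x l)
        ≈⟨ sum-cong-≋ {n} (λ l → trans (distribʳ _ _ _)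
                                  (+-congˡ (trans (sym (-‿distribˡ-* _ _)) (-‿cong (*-assoc _ _ _))))) ⟩
      sum (λ l → A (Fin.suc k) (Fin.suc l) * x l - mult k * (A Fin.zero (Fin.suc l) * x l))
        ≈⟨ sum-sub {n} _ (λ l → mult k * (A Fin.zero (Fin.suc l) * x l)) ⟩
      rowₛ x k - sum (λ l → mult k * (A Fin.zero (Fin.suc l) * x l))
        ≈⟨ +-congˡ (-‿cong (*-distribˡ-sum {n} (mult k) _)) ⟨
      rowₛ x k - mult k * row₀ x ∎

    -- prepend the unknown x₀ for which row 0 of A takes the value y₀
    extend : Carrier → (Fin n → Carrier) → Fin (suc n) → Carrier
    extend y₀ x = q * (y₀ - row₀ x) ∷ x

    extend-row₀ : ∀ y₀ x → (A ⊛ extend y₀ x) Fin.zero ≈ y₀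
    extend-row₀ y₀ x = begin
      A Fin.zero Fin.zero * (q * (y₀ - R)) + R ≈⟨ +-congʳ (*-assoc _ _ _) ⟨
      A Fin.zero Fin.zero * q * (y₀ - R) + R   ≈⟨ +-congʳ (trans (*-congʳ pq≈1) (*-identityˡ _)) ⟩
      y₀ - R + R                              ≈⟨ //-rightDividesˡ R y₀ ⟩
      y₀                                      ∎
      where
      R : Carrier
      R = row₀ x

    extend-rowₛ : ∀ y₀ x k → (A ⊛ extend y₀ x) (Fin.suc k) ≈ (schur ⊛ x) k + mult k * y₀
    extend-rowₛ y₀ x k = begin
      A (Fin.suc k) Fin.zero * (q * (y₀ - R)) + rowₛ x k ≈⟨ +-congʳ (*-assoc _ _ _) ⟨
      mult k * (y₀ - R) + rowₛ x k                     ≈⟨ +-congʳ (x[y-z]≈xy-xz _ _ _) ⟩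
      (mult k * y₀ - mult k * R) + rowₛ x k            ≈⟨ swap (mult k * y₀) (- (mult k * R)) (rowₛ x k) ⟩
      (rowₛ x k - mult k * R) + mult k * y₀            ≈⟨ +-congʳ (schur-row x k) ⟨
      (schur ⊛ x) k + mult k * y₀                      ∎
      where
      R : Carrier
      R = row₀ x
      swap : ∀ a b c → (a + b) + c ≈ (c + b) + a
      swap = solve 3 (λ a b c → (a ⊕ b) ⊕ c ⊜ (c ⊕ b) ⊕ a) refl

    schur-leading : LeadingInjective A → LeadingInjective schur
    schur-leading inj m m≤n x tail image l = inj (suc m) (s≤s m≤n) (extend 0# x) tail′ image′ (Fin.suc l)
      where
      tail′ : Vanish (suc m ≤_) (extend 0# x)
      tail′ (Fin.suc k) (s≤s m≤k) = tail k m≤k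
      image′ : Vanish (_< suc m) (A ⊛ extend 0# x)
      image′ Fin.zero _ = extend-row₀ 0# x
      image′ (Fin.suc k) (s≤s k<m) =
        trans (extend-rowₛ 0# x k) (trans (+-cong (image k k<m) (zeroʳ _)) (+-identityˡ 0#))

  solve-leading : ∀ {n} (A : Mat n) → LeadingInjective A →
                  ∀ (y : Fin n → Carrier) → Σ (Fin n → Carrier) (λ x → ∀ k → (A ⊛ x) k ≈ y k)
  solve-leading {zero}  A inj y = (λ ()) , (λ ())
  solve-leading {suc n} A inj y = extend (y Fin.zero) x′ , solves
    where
    pivot-inverse : ∃ λ q → A Fin.zero Fin.zero * q ≈ 1#
    pivot-inverse = inverse (A Fin.zero Fin.zero) (pivot≉0 A inj)
    open Pivot A (proj₁ pivot-inverse) (proj₂ pivot-inverse)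
    y′ : Fin n → Carrier
    y′ k = y (Fin.suc k) - mult k * y Fin.zero
    reduced : Σ (Fin n → Carrier) (λ x → ∀ k → (schur ⊛ x) k ≈ y′ k)
    reduced = solve-leading schur (schur-leading inj) y′
    x′ : Fin n → Carrier
    x′ = proj₁ reduced
    solves : ∀ k → (A ⊛ extend (y Fin.zero) x′) k ≈ y k
    solves Fin.zero    = extend-row₀ _ x′
    solves (Fin.suc k) = trans (extend-rowₛ _ x′ k) (trans (+-congʳ (proj₂ reduced k)) (//-rightDividesˡ _ _))

  -- the columns of B solve A x = e_j, so A B = I; then A (B A - I) = 0 and
  -- injectivity of A (the case m = n) gives B A = I
  leading-injective⇒invertible : ∀ {n} (A : Mat n) → LeadingInjective A → Invertible A
  leading-injective⇒invertible {n} A inj = B , AB≈I , BA≈I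
    where
    column : ∀ j → Σ (Fin n → Carrier) (λ x → ∀ k → (A ⊛ x) k ≈ I k j)
    column j = solve-leading A inj (λ k → I k j)
    B : Mat n
    B k j = proj₁ (column j) k
    AB≈I : (A · B) ≈Mat I
    AB≈I i j = trans (reflexive (ΣF≡sum n _)) (proj₂ (column j) i)
    A-injective : ∀ x → (∀ k → (A ⊛ x) k ≈ 0#) → ∀ l → x l ≈ 0#
    A-injective x Ax≈0 =
      inj n ℕP.≤-refl x (λ l n≤l → contradiction (FinP.toℕ<n l) (ℕP.≤⇒≯ n≤l)) (λ k _ → Ax≈0 k)
    A-column : ∀ j k → (A ⊛ (λ l → I l j)) k ≈ A k j
    A-column j k = begin
      (A ⊛ (λ l → I l j)) k ≈⟨ sum-single _ j (λ l l≢j → trans (*-congˡ (I-off l j l≢j)) (zeroʳ _)) ⟩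
      A k j * I j j         ≈⟨ trans (*-congˡ (I-diag j)) (*-identityʳ _) ⟩
      A k j                 ∎
    ABA≈A : ∀ j k → (A ⊛ (λ l → (B · A) l j)) k ≈ A k j
    ABA≈A j k = begin
      (A ⊛ (λ l → (B · A) l j)) k       ≈⟨ ⊛-cong A (λ l → reflexive (ΣF≡sum n _)) k ⟩
      (A ⊛ (B ⊛ (λ l → A l j))) k       ≈⟨ ⊛-· A B _ k ⟨
      ((A · B) ⊛ (λ l → A l j)) k       ≈⟨ sum-cong-≋ {n} (λ l → *-congʳ (AB≈I k l)) ⟩
      (I ⊛ (λ l → A l j)) k             ≈⟨ ⊛-I _ k ⟩
      A k j                             ∎
    BA≈I : (B · A) ≈Mat I
    BA≈I i j = x∙y⁻¹≈ε⇒x≈y _ _ (A-injective (λ l → (B · A) l j - I l j) image i)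
      where
      image : ∀ k → (A ⊛ (λ l → (B · A) l j - I l j)) k ≈ 0#
      image k = trans (⊛-sub A _ _ k) (trans (+-cong (ABA≈A j k) (-‿cong (A-column j k))) (-‿inverseʳ _))

module Windows {c ℓ} (F : CommutativeRing c ℓ) where
  open CommutativeRing F
  open LinAlg F
  open Matrices F
  open import Relation.Binary.Reasoning.Setoid setoid

  Σℕ : ℕ → (ℕ → Carrier) → Carrier
  Σℕ n g = sum {n} (λ k → g (toℕ k))

  Σℕ-+ : ∀ p q g → Σℕ (p ℕ.+ q) g ≈ Σℕ p g + Σℕ q (λ l → g (p ℕ.+ l))
  Σℕ-+ zero    q g = sym (+-identityˡ _)
  Σℕ-+ (suc p) q g = trans (+-congˡ (Σℕ-+ p q (λ k → g (suc k)))) (sym (+-assoc _ _ _))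

  Σℕ-zero : ∀ n g → (∀ k → k < n → g k ≈ 0#) → Σℕ n g ≈ 0#
  Σℕ-zero n g g≈0 = sum-zero {n} _ (λ k → g≈0 (toℕ k) (FinP.toℕ<n k))

  Σℕ-window : ∀ i n q g → (∀ k → k < i → g k ≈ 0#) → (∀ k → i ℕ.+ n ≤ k → g k ≈ 0#) →
              Σℕ (i ℕ.+ (n ℕ.+ q)) g ≈ Σℕ n (λ l → g (i ℕ.+ l))
  Σℕ-window i n q g below above = begin
    Σℕ (i ℕ.+ (n ℕ.+ q)) g                                         ≈⟨ Σℕ-+ i (n ℕ.+ q) g ⟩
    Σℕ i g + Σℕ (n ℕ.+ q) (λ l → g (i ℕ.+ l))
      ≈⟨ +-cong (Σℕ-zero i g below) (Σℕ-+ n q (λ l → g (i ℕ.+ l))) ⟩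
    0# + (Σℕ n (λ l → g (i ℕ.+ l)) + Σℕ q (λ l → g (i ℕ.+ (n ℕ.+ l)))) ≈⟨ +-identityˡ _ ⟩
    Σℕ n (λ l → g (i ℕ.+ l)) + Σℕ q (λ l → g (i ℕ.+ (n ℕ.+ l)))        ≈⟨ +-congˡ (Σℕ-zero q _ beyond) ⟩
    Σℕ n (λ l → g (i ℕ.+ l)) + 0#                                 ≈⟨ +-identityʳ _ ⟩
    Σℕ n (λ l → g (i ℕ.+ l))                                      ∎
    where
    beyond : ∀ l → l < q → g (i ℕ.+ (n ℕ.+ l)) ≈ 0#
    beyond l _ = above _ (ℕP.≤-trans (ℕP.m≤m+n (i ℕ.+ n) l) (ℕP.≤-reflexive (ℕP.+-assoc i n l)))

  ext : ∀ {n} → (Fin n → Carrier) → ℕ → Carrier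
  ext {n} x k with k ℕ.<? n
  ... | yes k<n = x (Fin.fromℕ< k<n)
  ... | no  _   = 0#

  ext-toℕ : ∀ {n} (x : Fin n → Carrier) k → ext x (toℕ k) ≈ x k
  ext-toℕ {n} x k with toℕ k ℕ.<? n
  ... | yes k<n = reflexive (≡.cong x (FinP.fromℕ<-toℕ k k<n))
  ... | no  k≮n = contradiction (FinP.toℕ<n k) k≮n

  ext-vanish : ∀ {n} {P : ℕ → Set} (x : Fin n → Carrier) → Vanish P x → ∀ k → P k → ext x k ≈ 0#
  ext-vanish {n} {P} x x-vanish k Pk with k ℕ.<? n
  ... | yes k<n = x-vanish _ (≡.subst P (≡.sym (FinP.toℕ-fromℕ< k<n)) Pk)
  ... | no  _   = refl

  ext-fromℕ< : ∀ {n} (x : Fin n → Carrier) k (k<n : k < n) → ext x k ≈ x (Fin.fromℕ< k<n)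
  ext-fromℕ< {n} x k k<n with k ℕ.<? n
  ... | yes k<n′ = reflexive (≡.cong x (FinP.fromℕ<-cong k k ≡.refl k<n′ k<n))
  ... | no  k≮n  = contradiction k<n k≮n

  shift : ∀ {n n′} → ℕ → (Fin n → Carrier) → Fin n′ → Carrier
  shift i c k with i ℕ.≤? toℕ k
  ... | yes _ = ext c (toℕ k ∸ i)
  ... | no  _ = 0#

  shift-at : ∀ {n n′} i (c : Fin n → Carrier) (k : Fin n′) → i ≤ toℕ k → shift i c k ≈ ext c (toℕ k ∸ i)
  shift-at i c k i≤k with i ℕ.≤? toℕ k
  ... | yes _   = refl
  ... | no  i≰k = contradiction i≤k i≰k

  shift-below : ∀ {n n′} i (c : Fin n → Carrier) → Vanish {n′} (_< i) (shift i c)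
  shift-below i c k k<i with i ℕ.≤? toℕ k
  ... | yes i≤k = contradiction i≤k (ℕP.<⇒≱ k<i)
  ... | no  _   = refl

  shift-tail : ∀ {n n′} i m (c : Fin n → Carrier) → Vanish (m ≤_) c → Vanish {n′} (i ℕ.+ m ≤_) (shift i c)
  shift-tail i m c tail k le =
    trans (shift-at i c k (ℕP.m+n≤o⇒m≤o i le))
          (ext-vanish {P = m ≤_} c tail _ (ℕP.m+n≤o⇒m≤o∸n m (≡.subst (_≤ toℕ k) (ℕP.+-comm i m) le)))

  shift-window : ∀ {n n′} i (c : Fin n → Carrier) (l : Fin n) → i ℕ.+ toℕ l < n′ →
                 ext (shift {n′ = n′} i c) (i ℕ.+ toℕ l) ≈ c l
  shift-window {n′ = n′} i c l in-range = begin
    ext (shift {n′ = n′} i c) (i ℕ.+ toℕ l) ≈⟨ ext-fromℕ< (shift i c) _ in-range ⟩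
    shift i c (Fin.fromℕ< in-range)
      ≈⟨ shift-at i c _ (≡.subst (i ≤_) (≡.sym (FinP.toℕ-fromℕ< in-range)) (ℕP.m≤m+n i _)) ⟩
    ext c (toℕ (Fin.fromℕ< in-range) ∸ i) ≡⟨ ≡.cong (λ k → ext c (k ∸ i)) (FinP.toℕ-fromℕ< in-range) ⟩
    ext c (i ℕ.+ toℕ l ∸ i)               ≡⟨ ≡.cong (ext c) (ℕP.m+n∸m≡n i (toℕ l)) ⟩
    ext c (toℕ l)                         ≈⟨ ext-toℕ c l ⟩
    c l                                   ∎

  module Submatrix {d : ℕ} (T : Mat (suc d)) where

    entry-toℕ : ∀ k l → entry T (toℕ k) (toℕ l) ≈ T k l
    entry-toℕ k l with toℕ k ℕ.<? suc d | toℕ l ℕ.<? suc d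
    ... | yes k<n | yes l<n = reflexive (≡.cong₂ T (FinP.fromℕ<-toℕ k k<n) (FinP.fromℕ<-toℕ l l<n))
    ... | no  k≮n | _       = contradiction (FinP.toℕ<n k) k≮n
    ... | yes _   | no  l≮n = contradiction (FinP.toℕ<n l) l≮n

    window-end : ∀ {i j} → i ≤ j → i ℕ.+ suc (j ∸ i) ≡ suc j
    window-end {i} i≤j = ≡.trans (ℕP.+-suc i _) (≡.cong suc (ℕP.m+[n∸m]≡n i≤j))

    -- [0, d] = [0, i) ∪ [i, j] ∪ (j, d]
    window-size : ∀ {i j} → i ≤ j → j ≤ d → i ℕ.+ (suc (j ∸ i) ℕ.+ (d ∸ j)) ≡ suc d
    window-size {i} {j} i≤j j≤d =
      ≡.trans (≡.sym (ℕP.+-assoc i _ _))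
              (≡.trans (≡.cong (ℕ._+ (d ∸ j)) (window-end i≤j)) (≡.cong suc (ℕP.m+[n∸m]≡n j≤d)))

    row-window : ∀ i j → i ≤ j → j ≤ d → (b : Fin (suc d) → Carrier) → Vanish (_< i) b → Vanish (j <_) b →
                 ∀ (a : Fin (suc d)) (a′ : Fin (suc (j ∸ i))) → toℕ a ≡ toℕ a′ →
                 (T ⊛ b) a ≈ (Sub T i j ⊛ (λ l → ext b (i ℕ.+ toℕ l))) a′
    row-window i j i≤j j≤d b below above a a′ a≡a′ = begin
      (T ⊛ b) a                             ≈⟨ sum-cong-≋ {suc d} (λ k → *-cong (entry≈ k) (ext-toℕ b k)) ⟨
      Σℕ (suc d) g                          ≡⟨ ≡.cong (λ n → Σℕ n g) (window-size i≤j j≤d) ⟨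
      Σℕ (i ℕ.+ (suc (j ∸ i) ℕ.+ (d ∸ j))) g ≈⟨ Σℕ-window i _ _ g below′ above′ ⟩
      Σℕ (suc (j ∸ i)) (λ l → g (i ℕ.+ l))  ∎
      where
      g : ℕ → Carrier
      g k = entry T (toℕ a′) k * ext b k
      entry≈ : ∀ k → entry T (toℕ a′) (toℕ k) ≈ T a k
      entry≈ k = ≡.subst (λ r → entry T r (toℕ k) ≈ T a k) a≡a′ (entry-toℕ a k)
      below′ : ∀ k → k < i → g k ≈ 0#
      below′ k k<i = trans (*-congˡ (ext-vanish b below k k<i)) (zeroʳ _)
      above′ : ∀ k → i ℕ.+ suc (j ∸ i) ≤ k → g k ≈ 0#
      above′ k le = trans (*-congˡ (ext-vanish b above k (≡.subst (_≤ k) (window-end i≤j) le))) (zeroʳ _)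

module MatrixForm {c ℓ} (F : CommutativeRing c ℓ) (F-field : LinAlg.IsField F) {d : ℕ}
                  (T : LinAlg.Mat F (suc d)) where
  open CommutativeRing F
  open LinAlg F
  open Matrices F
  open Elimination F F-field
  open Windows F
  open Submatrix T
  open import Relation.Binary.Reasoning.Setoid setoid

  WindowInjective : Set (c ⊔ ℓ)
  WindowInjective = ∀ t s (b : Fin (suc d) → Carrier) →
    Vanish (_< t) b → Vanish (t ℕ.+ s ≤_) b → Vanish (_< s) (T ⊛ b) → ∀ k → b k ≈ 0#

  invertible-window : ∀ t j s → t ≤ j → j ≤ d → j ∸ t < s → Invertible (Sub T t j) →
    ∀ (b : Fin (suc d) → Carrier) → Vanish (_< t) b → Vanish (j <_) b → Vanish (_< s) (T ⊛ b) → ∀ k → b k ≈ 0#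
  invertible-window t j s t≤j j≤d small (B , _ , BM≈I) b below above image k
    with toℕ k ℕ.<? t | j ℕ.<? toℕ k
  ... | yes k<t | _       = below k k<t
  ... | no  _   | yes j<k = above k j<k
  ... | no  k≮t | no  j≮k = begin
    b k                       ≈⟨ ext-toℕ b k ⟨
    ext b (toℕ k)             ≡⟨ ≡.cong (ext b) position ⟨
    ext b (t ℕ.+ toℕ l)       ≈⟨ left-invertible⇒injective {A = Sub T t j} {B = B} BM≈I window window-image l ⟩
    0#                        ∎
    where
    t≤k : t ≤ toℕ k
    t≤k = ℕP.≮⇒≥ k≮t
    l : Fin (suc (j ∸ t))
    l = Fin.fromℕ< (s≤s (ℕP.∸-monoˡ-≤ t (ℕP.≮⇒≥ j≮k)))
    position : t ℕ.+ toℕ l ≡ toℕ k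
    position = ≡.trans (≡.cong (t ℕ.+_) (FinP.toℕ-fromℕ< _)) (ℕP.m+[n∸m]≡n t≤k)
    window : Fin (suc (j ∸ t)) → Carrier
    window l = ext b (t ℕ.+ toℕ l)
    window-image : ∀ a′ → (Sub T t j ⊛ window) a′ ≈ 0#
    window-image a′ = trans (sym (row-window t j t≤j j≤d b below above a a′ (FinP.toℕ-fromℕ< _)))
                            (image a (≡.subst (_< s) (≡.sym (FinP.toℕ-fromℕ< _)) (ℕP.<-≤-trans (FinP.toℕ<n a′) small)))
      where
      a : Fin (suc d)
      a = Fin.fromℕ< (ℕP.<-≤-trans (FinP.toℕ<n a′) (s≤s (ℕP.≤-trans (ℕP.m∸n≤m j t) j≤d)))

  -- for s > 0 choose the window [t, min (t+s-1, d)] and apply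
  -- invertible-window; for s = 0 the support [t, t) is empty
  veryGood⇒windowInjective : VeryGood T → WindowInjective
  veryGood⇒windowInjective good t zero b below above image k with toℕ k ℕ.<? t
  ... | yes k<t = below k k<t
  ... | no  k≮t = above k (≡.subst (_≤ toℕ k) (≡.sym (ℕP.+-identityʳ t)) (ℕP.≮⇒≥ k≮t))
  veryGood⇒windowInjective good t (suc s) b below above image with t ℕ.≤? d | t ℕ.+ s ℕ.≤? d
  ... | no t≰d | _ = λ k → below k (ℕP.<-≤-trans (FinP.toℕ<n k) (ℕP.≰⇒> t≰d))
  ... | yes _ | yes t+s≤d =
    invertible-window t (t ℕ.+ s) (suc s) (ℕP.m≤m+n t s) t+s≤d (s≤s (ℕP.≤-reflexive (ℕP.m+n∸m≡n t s)))
                      (good t (t ℕ.+ s) (ℕP.m≤m+n t s) t+s≤d) b below above′ image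
    where
    above′ : Vanish (t ℕ.+ s <_) b
    above′ k t+s<k = above k (≡.subst (_≤ toℕ k) (≡.sym (ℕP.+-suc t s)) t+s<k)
  ... | yes t≤d | no t+s≰d =
    invertible-window t d (suc s) t≤d ℕP.≤-refl (s≤s (ℕP.m≤n+o⇒m∸n≤o d t (ℕP.<⇒≤ (ℕP.≰⇒> t+s≰d))))
                      (good t d t≤d ℕP.≤-refl) b below beyond image
    where
    beyond : Vanish (d <_) b
    beyond k d<k = contradiction (FinP.toℕ<n k) (ℕP.<⇒≱ (s≤s d<k))

  -- a vector c witnessing non-injectivity of a leading block of T[i,j],
  -- shifted to the positions i, i+1, …, contradicts window-injectivity
  windowInjective⇒veryGood : WindowInjective → VeryGood T
  windowInjective⇒veryGood injective i j i≤j j≤d = leading-injective⇒invertible (Sub T i j) leading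
    where
    n : ℕ
    n = suc (j ∸ i)
    in-range : ∀ (l : Fin n) → i ℕ.+ toℕ l < suc d
    in-range l = ℕP.<-≤-trans (ℕP.+-monoʳ-< i (FinP.toℕ<n l))
                              (ℕP.≤-trans (ℕP.≤-reflexive (window-end i≤j)) (s≤s j≤d))
    leading : LeadingInjective (Sub T i j)
    leading m m≤n c tail image l = begin
      c l                     ≈⟨ shift-window i c l (in-range l) ⟨
      ext b (i ℕ.+ toℕ l)     ≈⟨ ext-fromℕ< b _ (in-range l) ⟩
      b (Fin.fromℕ< _)        ≈⟨ injective i m b (shift-below i c) (shift-tail i m c tail) b-image _ ⟩
      0#                      ∎
      where
      b : Fin (suc d) → Carrier
      b = shift i c
      beyond-j : Vanish (j <_) b
      beyond-j k j<k = shift-tail i n c (λ l n≤l → contradiction (FinP.toℕ<n l) (ℕP.≤⇒≯ n≤l)) k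
                                  (≡.subst (_≤ toℕ k) (≡.sym (window-end i≤j)) j<k)
      b-image : Vanish (_< m) (T ⊛ b)
      b-image a a<m = begin
        (T ⊛ b) a
          ≈⟨ row-window i j i≤j j≤d b (shift-below i c) beyond-j a a′ (≡.sym (FinP.toℕ-fromℕ< _)) ⟩
        (Sub T i j ⊛ (λ l → ext b (i ℕ.+ toℕ l))) a′
          ≈⟨ ⊛-cong (Sub T i j) (λ l → shift-window i c l (in-range l)) a′ ⟩
        (Sub T i j ⊛ c) a′                           ≈⟨ image a′ (≡.subst (_< m) (≡.sym (FinP.toℕ-fromℕ< _)) a<m) ⟩
        0#                                           ∎
        where
        a′ : Fin n
        a′ = Fin.fromℕ< (ℕP.<-≤-trans a<m m≤n)

module Coordinates {c ℓ m ℓm} (F : CommutativeRing c ℓ) (V : Module F m ℓm) where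
  open CommutativeRing F
  open LinAlg F
  open Matrices F
  open Space V
  open Module V using (Carrierᴹ; _≈ᴹ_; _+ᴹ_; 0ᴹ; _*ₗ_; +ᴹ-commutativeMonoid; +ᴹ-abelianGroup; ≈ᴹ-setoid;
                        ≈ᴹ-refl; ≈ᴹ-sym; ≈ᴹ-trans; +ᴹ-congˡ; *ₗ-cong; *ₗ-assoc; *ₗ-distribˡ; *ₗ-distribʳ;
                        *ₗ-zeroˡ; *ₗ-zeroʳ; ≈ᴹ-reflexive)
  module VS = FiniteSums +ᴹ-commutativeMonoid
  open import Algebra.Properties.AbelianGroup +ᴹ-abelianGroup using (identityˡ-unique)
  open import Algebra.Properties.Ring ring using (x∙y⁻¹≈ε⇒x≈y; //-rightDividesˡ)
  open import Relation.Binary.Reasoning.Setoid ≈ᴹ-setoid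

  lincomb≡sum : ∀ {n} (a : Fin n → Carrier) w → lincomb a w ≡ VS.sum (λ k → a k *ₗ w k)
  lincomb≡sum {zero}  a w = ≡.refl
  lincomb≡sum {suc n} a w = ≡.cong (a Fin.zero *ₗ w Fin.zero +ᴹ_) (lincomb≡sum (λ k → a (Fin.suc k)) (λ k → w (Fin.suc k)))

  *ₗ-sum : ∀ {n} x (f : Fin n → Carrierᴹ) → x *ₗ VS.sum f ≈ᴹ VS.sum (λ k → x *ₗ f k)
  *ₗ-sum {zero}  x f = *ₗ-zeroʳ x
  *ₗ-sum {suc n} x f = ≈ᴹ-trans (*ₗ-distribˡ x _ _) (+ᴹ-congˡ (*ₗ-sum x (λ k → f (Fin.suc k))))

  sum-*ₗ : ∀ {n} (g : Fin n → Carrier) w → sum g *ₗ w ≈ᴹ VS.sum (λ k → g k *ₗ w)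
  sum-*ₗ {zero}  g w = *ₗ-zeroˡ w
  sum-*ₗ {suc n} g w = ≈ᴹ-trans (*ₗ-distribʳ w _ _) (+ᴹ-congˡ (sum-*ₗ (λ k → g (Fin.suc k)) w))

  lincomb-cong : ∀ {n} {a a′ : Fin n → Carrier} {w} → (∀ k → a k ≈ a′ k) → lincomb a w ≈ᴹ lincomb a′ w
  lincomb-cong {n} {a} {a′} {w} a≈a′ = begin
    lincomb a w                ≡⟨ lincomb≡sum a w ⟩
    VS.sum (λ k → a k *ₗ w k)  ≈⟨ VS.sum-cong-≋ {n} (λ k → *ₗ-cong (a≈a′ k) ≈ᴹ-refl) ⟩
    VS.sum (λ k → a′ k *ₗ w k) ≡⟨ lincomb≡sum a′ w ⟨
    lincomb a′ w               ∎

  lincomb-zero : ∀ {n} (a : Fin n → Carrier) w → (∀ k → a k ≈ 0#) → lincomb a w ≈ᴹ 0ᴹ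
  lincomb-zero a w a≈0 = ≈ᴹ-trans (≈ᴹ-reflexive (lincomb≡sum a w))
                           (VS.sum-zero _ (λ k → ≈ᴹ-trans (*ₗ-cong (a≈0 k) ≈ᴹ-refl) (*ₗ-zeroˡ (w k))))

  lincomb-+ : ∀ {n} (a a′ : Fin n → Carrier) w → lincomb (λ k → a k + a′ k) w ≈ᴹ lincomb a w +ᴹ lincomb a′ w
  lincomb-+ {n} a a′ w = begin
    lincomb (λ k → a k + a′ k) w                   ≡⟨ lincomb≡sum _ w ⟩
    VS.sum (λ k → (a k + a′ k) *ₗ w k)              ≈⟨ VS.sum-cong-≋ {n} (λ k → *ₗ-distribʳ (w k) (a k) (a′ k)) ⟩
    VS.sum (λ k → a k *ₗ w k +ᴹ a′ k *ₗ w k)        ≈⟨ VS.∑-distrib-+ {n} (λ k → a k *ₗ w k) _ ⟩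
    VS.sum (λ k → a k *ₗ w k) +ᴹ VS.sum (λ k → a′ k *ₗ w k)
      ≡⟨ ≡.cong₂ _+ᴹ_ (lincomb≡sum a w) (lincomb≡sum a′ w) ⟨
    lincomb a w +ᴹ lincomb a′ w                    ∎

  lincomb-⊛ : ∀ {n} (A : Mat n) (w : Fin n → Carrierᴹ) b →
              lincomb b (λ j → lincomb (λ i → A i j) w) ≈ᴹ lincomb (A ⊛ b) w
  lincomb-⊛ {n} A w b = begin
    lincomb b (λ j → lincomb (λ i → A i j) w)
      ≈⟨ ≈ᴹ-reflexive (lincomb≡sum b _) ⟩
    VS.sum (λ j → b j *ₗ lincomb (λ i → A i j) w)
      ≈⟨ VS.sum-cong-≋ {n} (λ j → *ₗ-cong refl (≈ᴹ-reflexive (lincomb≡sum _ w))) ⟩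
    VS.sum (λ j → b j *ₗ VS.sum (λ i → A i j *ₗ w i))
      ≈⟨ VS.sum-cong-≋ {n} (λ j → *ₗ-sum {n} (b j) _) ⟩
    VS.sum (λ j → VS.sum (λ i → b j *ₗ (A i j *ₗ w i)))
      ≈⟨ VS.sum-cong-≋ {n} (λ j → VS.sum-cong-≋ {n} (λ i → ≈ᴹ-sym (*ₗ-assoc _ _ _))) ⟩
    VS.sum (λ j → VS.sum (λ i → (b j * A i j) *ₗ w i))
      ≈⟨ VS.∑-comm {n} {n} _ ⟩
    VS.sum (λ i → VS.sum (λ j → (b j * A i j) *ₗ w i))
      ≈⟨ VS.sum-cong-≋ {n} (λ i → VS.sum-cong-≋ {n} (λ j → *ₗ-cong (*-comm _ _) ≈ᴹ-refl)) ⟩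
    VS.sum (λ i → VS.sum (λ j → (A i j * b j) *ₗ w i))
      ≈⟨ VS.sum-cong-≋ {n} (λ i → sum-*ₗ {n} (λ j → A i j * b j) (w i)) ⟨
    VS.sum (λ i → (A ⊛ b) i *ₗ w i)
      ≡⟨ lincomb≡sum (A ⊛ b) w ⟨
    lincomb (A ⊛ b) w
      ∎

  coordinates-unique : ∀ {n} {u : Fin n → Carrierᴹ} → IsBasis u →
                       ∀ a a′ → lincomb a u ≈ᴹ lincomb a′ u → ∀ k → a k ≈ a′ k
  coordinates-unique {u = u} (independent , _) a a′ same k =
    x∙y⁻¹≈ε⇒x≈y (a k) (a′ k) (independent (λ k → a k - a′ k) difference≈0 k)
    where
    difference≈0 : lincomb (λ k → a k - a′ k) u ≈ᴹ 0ᴹ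
    difference≈0 = identityˡ-unique _ (lincomb a′ u) (begin
      lincomb (λ k → a k - a′ k) u +ᴹ lincomb a′ u ≈⟨ lincomb-+ (λ k → a k - a′ k) a′ u ⟨
      lincomb (λ k → a k - a′ k + a′ k) u          ≈⟨ lincomb-cong (λ k → //-rightDividesˡ (a′ k) (a k)) ⟩
      lincomb a u                                  ≈⟨ same ⟩
      lincomb a′ u                                 ∎)

reorder : ∀ r s t → r ℕ.+ s ℕ.+ t ≡ t ℕ.+ s ℕ.+ r
reorder = solve-∀

beyond-opposite : ∀ {d r s t k} → r ≤ d → d < r ℕ.+ s ℕ.+ t → t ℕ.+ s ≤ k → ¬ (k ≤ d ∸ r)
beyond-opposite {d} {r} {s} {t} {k} r≤d d<r+s+t t+s≤k k≤d∸r =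
  ℕP.<⇒≱ d<r+s+t (ℕP.≤-trans (ℕP.≤-reflexive (reorder r s t))
                              (ℕP.≤-trans (ℕP.+-monoˡ-≤ r t+s≤k) (ℕP.m≤o∸n⇒m+n≤o k r≤d k≤d∸r)))

beyond-complement : ∀ {d w k} → k ≤ d → ¬ (k ≤ d ∸ (suc d ∸ w)) → w ≤ k
beyond-complement {d} {w} {k} k≤d k≰ with w ℕ.≤? k
... | yes w≤k = w≤k
... | no  w≰k = contradiction (ℕP.m+n≤o⇒m≤o∸n k fits) k≰
  where
  fits : k ℕ.+ (suc d ∸ w) ≤ d
  fits with w ℕ.≤? suc d
  ... | yes w≤n = ℕP.≤-pred (ℕP.≤-trans (ℕP.+-monoˡ-< (suc d ∸ w) (ℕP.≰⇒> w≰k))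
                                        (ℕP.≤-reflexive (ℕP.m+[n∸m]≡n w≤n)))
  ... | no  w≰n = ℕP.≤-trans (ℕP.≤-reflexive (≡.trans (≡.cong (k ℕ.+_) complement≡0) (ℕP.+-identityʳ k))) k≤d
    where
    complement≡0 : suc d ∸ w ≡ 0
    complement≡0 = ℕP.m≤n⇒m∸n≡0 (ℕP.<⇒≤ (ℕP.≰⇒> w≰n))

complement-total : ∀ d s t → d < (suc d ∸ (t ℕ.+ s)) ℕ.+ s ℕ.+ t
complement-total d s t = ℕP.≤-trans (ℕP.m≤n+m∸n (suc d) (t ℕ.+ s)) (ℕP.≤-reflexive (≡.sym (reorder _ s t)))

complement-index : ∀ d w → 0 < w → suc d ∸ w < suc d
complement-index d (suc w) _ = s≤s (ℕP.m∸n≤m d w)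

module Flags {c ℓ m ℓm} (F : CommutativeRing c ℓ) (F-field : LinAlg.IsField F) (V : Module F m ℓm) (d : ℕ)
             (T : LinAlg.Mat F (suc d)) (T-invertible : LinAlg.Invertible F T) (T-upper : LinAlg.UpperTriangular F T)
             (u : Fin (suc d) → Module.Carrierᴹ V) (u-basis : LinAlg.Space.IsBasis F V u) where
  open CommutativeRing F
  open LinAlg F
  open Space V
  open Module V using (Carrierᴹ; _≈ᴹ_; 0ᴹ; ≈ᴹ-refl; ≈ᴹ-sym; ≈ᴹ-trans)
  open Matrices F
  open Coordinates F V
  open MatrixForm F F-field T

  v : Fin (suc d) → Carrierᴹ
  v j = lincomb (λ i → T i j) u

  U U′ U″ : Fin (suc d) → Subspace (c ⊔ ℓ ⊔ ℓm)
  U i = Span u (λ k → toℕ k ≤ toℕ i)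
  U′ i = Span u (λ k → d ∸ toℕ i ≤ toℕ k)
  U″ i = Span v (λ k → d ∸ toℕ i ≤ toℕ k)

  v-coordinates : ∀ b → lincomb b v ≈ᴹ lincomb (T ⊛ b) u
  v-coordinates = lincomb-⊛ T u

  T-injective : ∀ b → (∀ k → (T ⊛ b) k ≈ 0#) → ∀ k → b k ≈ 0#
  T-injective = left-invertible⇒injective {A = T} {B = proj₁ T-invertible} (proj₂ (proj₂ T-invertible))

  flag-index : ∀ (s : Fin (suc d)) → d ∸ toℕ (opposite s) ≡ toℕ s
  flag-index s = ≡.trans (≡.cong (d ∸_) (FinP.opposite-prop s)) (ℕP.m∸[m∸n]≡n (ℕP.≤-pred (FinP.toℕ<n s)))

  flag-at : ∀ {i} (i<n : i < suc d) → d ∸ toℕ (opposite (Fin.fromℕ< i<n)) ≡ i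
  flag-at i<n = ≡.trans (flag-index _) (FinP.toℕ-fromℕ< i<n)

  windowInjective⇒totallyOpposite : WindowInjective → TotallyOpposite U U′ U″
  windowInjective⇒totallyOpposite injective r s t r+s+t>d x
    (a , a-support , x≈a) (a′ , a′-support , x≈a′) (b , b-support , x≈b) =
    ≈ᴹ-trans x≈b (lincomb-zero b v (injective (toℕ t) (toℕ s) b below tail image))
    where
    Tb≈ : ∀ {a : Fin (suc d) → Carrier} → x ≈ᴹ lincomb a u → ∀ k → (T ⊛ b) k ≈ a k
    Tb≈ {a} x≈a = coordinates-unique {u = u} u-basis (T ⊛ b) a
                    (≈ᴹ-trans (≈ᴹ-sym (v-coordinates b)) (≈ᴹ-trans (≈ᴹ-sym x≈b) x≈a))
    below : Vanish (_< toℕ t) b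
    below k k<t = b-support k (λ t≤k → ℕP.<⇒≱ k<t (≡.subst (_≤ toℕ k) (flag-index t) t≤k))
    image : Vanish (_< toℕ s) (T ⊛ b)
    image k k<s =
      trans (Tb≈ {a′} x≈a′ k) (a′-support k (λ s≤k → ℕP.<⇒≱ k<s (≡.subst (_≤ toℕ k) (flag-index s) s≤k)))
    tail : Vanish (toℕ t ℕ.+ toℕ s ≤_) b
    tail = upper-reflects-tail T-upper T-invertible _ b λ k t+s≤k →
      trans (Tb≈ {a} x≈a k)
            (a-support k (beyond-opposite (ℕP.≤-pred (FinP.toℕ<n r)) r+s+t>d t+s≤k
                          ∘ ≡.subst (toℕ k ≤_) (FinP.opposite-prop r)))

  -- For a potential counterexample b supported in [t, t+s), the vector
  -- Σ_j b_j v_j lies in U″_{d-t}, U′_{d-s} and U_{d-r} with r = d+1-(t+s).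
  totallyOpposite⇒windowInjective : TotallyOpposite U U′ U″ → WindowInjective
  totallyOpposite⇒windowInjective totally t s b below tail image k
    with toℕ k ℕ.<? t | t ℕ.+ s ℕ.≤? toℕ k | s ℕ.≤? d
  ... | yes k<t | _          | _     = below k k<t
  ... | no  _   | yes t+s≤k  | _     = tail k t+s≤k
  ... | no  _   | no  _      | no s≰d = T-injective b (λ k → image k (ℕP.<-≤-trans (FinP.toℕ<n k) (ℕP.≰⇒> s≰d))) k
  ... | no  k≮t | no  t+s≰k  | yes s≤d = T-injective b Tb≈0 k
    where
    w : ℕ
    w = t ℕ.+ s
    t≤d : t ≤ d
    t≤d = ℕP.≤-trans (ℕP.≮⇒≥ k≮t) (ℕP.≤-pred (FinP.toℕ<n k))
    r<n : suc d ∸ w < suc d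
    r<n = complement-index d w (ℕP.≤-trans (s≤s z≤n) (ℕP.≰⇒> t+s≰k))
    r′ s′ t′ : Fin (suc d)
    r′ = Fin.fromℕ< r<n
    s′ = Fin.fromℕ< (s≤s s≤d)
    t′ = Fin.fromℕ< (s≤s t≤d)
    x : Carrierᴹ
    x = lincomb b v
    total : d < toℕ r′ ℕ.+ toℕ s′ ℕ.+ toℕ t′
    total = ≡.subst (d <_) (≡.sym indices) (complement-total d s t)
      where
      indices : toℕ r′ ℕ.+ toℕ s′ ℕ.+ toℕ t′ ≡ (suc d ∸ (t ℕ.+ s)) ℕ.+ s ℕ.+ t
      indices = ≡.cong₂ ℕ._+_ (≡.cong₂ ℕ._+_ (FinP.toℕ-fromℕ< r<n) (FinP.toℕ-fromℕ< (s≤s s≤d)))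
                              (FinP.toℕ-fromℕ< (s≤s t≤d))
    in-U : U (opposite r′) x
    in-U = T ⊛ b , support , v-coordinates b
      where
      opposite-r : toℕ (opposite r′) ≡ d ∸ (suc d ∸ w)
      opposite-r = ≡.trans (FinP.opposite-prop r′) (≡.cong (d ∸_) (FinP.toℕ-fromℕ< r<n))
      support : ∀ k → ¬ (toℕ k ≤ toℕ (opposite r′)) → (T ⊛ b) k ≈ 0#
      support k outside = upper-preserves-tail T-upper w b tail k
        (beyond-complement (ℕP.≤-pred (FinP.toℕ<n k)) (outside ∘ ≡.subst (toℕ k ≤_) (≡.sym opposite-r)))
    in-U′ : U′ (opposite s′) x
    in-U′ = T ⊛ b , (λ k outside → image k (ℕP.≰⇒> (outside ∘ ≡.subst (_≤ toℕ k) (≡.sym (flag-at (s≤s s≤d))))))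
                  , v-coordinates b
    in-U″ : U″ (opposite t′) x
    in-U″ = b , (λ k outside → below k (ℕP.≰⇒> (outside ∘ ≡.subst (_≤ toℕ k) (≡.sym (flag-at (s≤s t≤d))))))
              , ≈ᴹ-refl
    x≈0 : x ≈ᴹ 0ᴹ
    x≈0 = totally r′ s′ t′ total x in-U in-U′ in-U″
    Tb≈0 : ∀ k → (T ⊛ b) k ≈ 0#
    Tb≈0 = coordinates-unique {u = u} u-basis (T ⊛ b) (λ _ → 0#)
             (≈ᴹ-trans (≈ᴹ-sym (v-coordinates b)) (≈ᴹ-trans x≈0 (≈ᴹ-sym (lincomb-zero _ u (λ _ → refl)))))

proposition4p12 : {c ℓ m ℓm : Level} (F : CommutativeRing c ℓ) → LinAlg.IsField F →
    (V : Module F m ℓm) → (d : ℕ) → (T : LinAlg.Mat F (suc d)) →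
    LinAlg.Invertible F T → LinAlg.UpperTriangular F T →
    (u : Fin (suc d) → Module.Carrierᴹ V) → LinAlg.Space.IsBasis F V u →
    let v : Fin (suc d) → Module.Carrierᴹ V
        v j = LinAlg.Space.lincomb F V (λ i → T i j) u
        U : Fin (suc d) → LinAlg.Space.Subspace F V _
        U i = LinAlg.Space.Span F V u (λ k → toℕ k ≤ toℕ i)
        U′ : Fin (suc d) → LinAlg.Space.Subspace F V _
        U′ i = LinAlg.Space.Span F V u (λ k → d ∸ toℕ i ≤ toℕ k)
        U″ : Fin (suc d) → LinAlg.Space.Subspace F V _
        U″ i = LinAlg.Space.Span F V v (λ k → d ∸ toℕ i ≤ toℕ k)
    in LinAlg.Space.TotallyOpposite F V U U′ U″ ⇔ LinAlg.VeryGood F T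
proposition4p12 F F-field V d T T-invertible T-upper u u-basis =
  mk⇔ (windowInjective⇒veryGood ∘ totallyOpposite⇒windowInjective)
      (windowInjective⇒totallyOpposite ∘ veryGood⇒windowInjective)
  where
  open MatrixForm F F-field T
  open Flags F F-field V d T T-invertible T-upper u u-basis
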